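{- Let $A,B,B',C$ be pairwise disjoint finite nonempty sets with $|A|<|B|=|B'|<|C|$ and $|A|\cdot|C|>|B|^2$. Let $G$ be the graph with vertex set $A\cup B\cup B'\cup C$ whose edge set is the union of the edge sets of the complete graphs on $A\cup B$, on $A\cup B'$, on $B\cup C$ and on $B'\cup C$. If $G'$ is a minimal chordal supergraph of $G$, then each of the induced subgraphs $G'[A\cup C]$ and $G'[B\cup B']$ is either a clique or the disjoint union of two cliques with no edges between them.
   Context: A graph is chordal if it has no induced cycle of length greater than $3$. A supergraph $G'$ of $G$ has $V(G')\supseteq V(G)$ and $E(G')\supseteq E(G)$; a minimal chordal supergraph of $G$ is a chordal supergraph of $G$ on the same vertex set such that no proper subgraph of it (on the same vertex set) that contains $G$ is chordal. $G'[X]$ denotes the subgraph induced by $X$. -}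

module Defs where

open import Data.Nat using (ℕ; zero; suc; _≤_; _<_)
open import Data.Fin using (Fin; toℕ)
open import Data.Bool using (Bool; true; false)
open import Data.Sum using (_⊎_; inj₁; inj₂)
open import Data.Product using (_×_; Σ; ∃; ∃-syntax)
open import Data.Empty using (⊥)
open import Relation.Nullary using (¬_)
open import Relation.Binary.PropositionalEquality using (_≡_; _≢_)
open import Function.Definitions using (Injective)
open import Function.Bundles using (_⇔_)
open import Level using (0ℓ)

record Graph (V : Set) : Set where
  field
    adj    : V → V → Bool
    sym    : ∀ u v → adj u v ≡ adj v u
    irrefl : ∀ v → adj v v ≡ false
open Graph public

Edge : {V : Set} → Graph V → V → V → Set
Edge G u v = adj G u v ≡ true

_⊆ᴳ_ : {V : Set} → Graph V → Graph V → Set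
H ⊆ᴳ K = ∀ u v → Edge H u v → Edge K u v

CycAdj : (k : ℕ) → Fin k → Fin k → Set
CycAdj k i j = (suc (toℕ i) ≡ toℕ j) ⊎ (suc (toℕ j) ≡ toℕ i)
             ⊎ ((toℕ i ≡ 0) × (suc (toℕ j) ≡ k))
             ⊎ ((toℕ j ≡ 0) × (suc (toℕ i) ≡ k))

InducedCycle : {V : Set} → Graph V → (k : ℕ) → (Fin k → V) → Set
InducedCycle G k f =
  Injective _≡_ _≡_ f × (∀ i j → Edge G (f i) (f j) ⇔ CycAdj k i j)

Chordal : {V : Set} → Graph V → Set
Chordal {V} G = ∀ k → 4 ≤ k → (f : Fin k → V) → ¬ InducedCycle G k f

MinimalChordalSupergraph : {V : Set} → (V → V → Set) → Graph V → Set
MinimalChordalSupergraph {V} E G' =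
  (∀ u v → E u v → Edge G' u v) × Chordal G' ×
  (∀ (H : Graph V) → (∀ u v → E u v → Edge H u v) → H ⊆ᴳ G' → Chordal H → G' ⊆ᴳ H)

IsCliqueOn : {V : Set} → Graph V → (V → Set) → Set
IsCliqueOn G X = ∀ u v → X u → X v → u ≢ v → Edge G u v

IsTwoCliquesOn : {V : Set} → Graph V → (V → Set) → Set
IsTwoCliquesOn {V} G X =
  Σ (V → Bool) λ P →
    (∃[ x ] (X x × P x ≡ true)) × (∃[ x ] (X x × P x ≡ false)) ×
    (∀ u v → X u → X v → u ≢ v → (Edge G u v ⇔ (P u ≡ P v)))

data Part : Set where
  pA pB pB' pC : Part

Vtx : ℕ → ℕ → ℕ → Set
Vtx a b c = Fin a ⊎ Fin b ⊎ Fin b ⊎ Fin c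

part : ∀ {a b c} → Vtx a b c → Part
part (inj₁ _) = pA
part (inj₂ (inj₁ _)) = pB
part (inj₂ (inj₂ (inj₁ _))) = pB'
part (inj₂ (inj₂ (inj₂ _))) = pC

data Block : Set where
  AB AB' BC B'C : Block

InBlock : Block → Part → Set
InBlock AB  p = (p ≡ pA) ⊎ (p ≡ pB)
InBlock AB' p = (p ≡ pA) ⊎ (p ≡ pB')
InBlock BC  p = (p ≡ pB) ⊎ (p ≡ pC)
InBlock B'C p = (p ≡ pB') ⊎ (p ≡ pC)

EdgeG : ∀ {a b c} → Vtx a b c → Vtx a b c → Set
EdgeG u v = (u ≢ v) × ∃[ β ] (InBlock β (part u) × InBlock β (part v))

InAC : ∀ {a b c} → Vtx a b c → Set
InAC v = (part v ≡ pA) ⊎ (part v ≡ pC)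

InBB' : ∀ {a b c} → Vtx a b c → Set
InBB' v = (part v ≡ pB) ⊎ (part v ≡ pB')

-- G is the blow-up of the square A – B – C – B' by cliques, so every choice of
-- a ∈ A, b ∈ B, c ∈ C, b' ∈ B' spans a 4-cycle a b c b' of G, and a chordal G'
-- must contain one of its diagonals ac or bb'. Hence either G' contains every
-- A–C pair, or some pair a, c is missing and then G' contains every B–B' pair.
-- Once one diagonal of the square is complete, G' contains every pair of
-- distinct vertices except possibly those across the other diagonal. Deleting
-- all of those leaves a graph whose non-edges form a complete bipartite graph,
-- which is chordal, so minimality forces G' to contain none of them.
module Submission where

open import Defs hiding (sym)
open import Data.Nat using (ℕ; suc; _≤_; _<_; _*_; s≤s)
open import Data.Nat.Properties using (≤-refl)
import Data.Nat as ℕ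
open import Data.Bool using (Bool; true; false; not; _∧_)
import Data.Bool as Bool
open import Data.Bool.Properties using (∧-zeroʳ)
open import Data.Fin using (Fin; toℕ; fromℕ<)
import Data.Fin.Properties as Fin
open import Data.Fin.Patterns using (0F; 1F; 2F; 3F)
open import Data.Product as Product using (_×_; _,_; proj₁; proj₂; ∃; ∃-syntax; ∃₂)
open import Data.Sum as Sum using (_⊎_; inj₁; inj₂)
open import Data.Empty using (⊥; ⊥-elim)
open import Function using (case_of_)
open import Function.Bundles using (_⇔_; mk⇔; Equivalence)
open import Function.Definitions using (Injective)
open import Relation.Nullary using (¬_; Dec; yes; no; does)
open import Relation.Nullary.Decidable
  using (map′; True; False; toWitness; toWitnessFalse; _×-dec_; _⊎-dec_; dec-true; dec-false; does-⇔)
import Relation.Unary as U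
open import Relation.Binary.Definitions using (Decidable; DecidableEquality)
open import Relation.Binary.PropositionalEquality
  using (_≡_; _≢_; refl; sym; trans; cong; cong₂; subst)

module _ {V : Set} (G : Graph V) where

  Edge-sym : ∀ {u v} → Edge G u v → Edge G v u
  Edge-sym {u} {v} e = trans (Graph.sym G v u) e

  Edge-irrefl : ∀ {v} → ¬ Edge G v v
  Edge-irrefl {v} e = case trans (sym e) (irrefl G v) of λ ()

  Edge? : Decidable (Edge G)
  Edge? u v = adj G u v Bool.≟ true

Across : {V : Set} → (V → Set) → (V → Set) → V → V → Set
Across S T u v = (S u × T v) ⊎ (T u × S v)

module _ {V : Set} {S T : V → Set} where

  Across-sym : ∀ {u v} → Across S T u v → Across S T v u
  Across-sym (inj₁ (su , tv)) = inj₂ (tv , su)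
  Across-sym (inj₂ (tu , sv)) = inj₁ (sv , tu)

  Across? : U.Decidable S → U.Decidable T → Decidable (Across S T)
  Across? S? T? u v = (S? u ×-dec T? v) ⊎-dec (T? u ×-dec S? v)

CycAdj? : ∀ k → Decidable (CycAdj k)
CycAdj? k i j =
  (suc (toℕ i) ℕ.≟ toℕ j) ⊎-dec (suc (toℕ j) ℕ.≟ toℕ i)
  ⊎-dec ((toℕ i ℕ.≟ 0) ×-dec (suc (toℕ j) ℕ.≟ k))
  ⊎-dec ((toℕ j ℕ.≟ 0) ×-dec (suc (toℕ i) ℕ.≟ k))

module _ {V : Set} (G : Graph V) {k : ℕ} (f : Fin k → V) (cycle : InducedCycle G k f) where

  InducedCycle-edge : ∀ i j → {True (CycAdj? k i j)} → Edge G (f i) (f j)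
  InducedCycle-edge i j {c} = Equivalence.from (proj₂ cycle i j) (toWitness c)

  InducedCycle-non-edge : ∀ i j → {False (CycAdj? k i j)} → ¬ Edge G (f i) (f j)
  InducedCycle-non-edge i j {c} e = toWitnessFalse c (Equivalence.to (proj₂ cycle i j) e)

square : {V : Set} → V → V → V → V → Fin 4 → V
square x u y v 0F = x
square x u y v 1F = u
square x u y v 2F = y
square x u y v 3F = v

module _ {V : Set} (G : Graph V) {x u y v : V} (x≢y : x ≢ y) (u≢v : u ≢ v)
  (xu : Edge G x u) (uy : Edge G u y) (yv : Edge G y v) (vx : Edge G v x) where

  private
    f : Fin 4 → V
    f = square x u y v

    distinct : ∀ {p q} → Edge G p q → p ≢ q
    distinct e refl = Edge-irrefl G e

    Adjacency : Fin 4 → Fin 4 → Set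
    Adjacency i j = Edge G (f i) (f j) ⇔ CycAdj 4 i j

  square-injective : Injective _≡_ _≡_ f
  square-injective {0F} {0F} _ = refl
  square-injective {0F} {1F} e = ⊥-elim (distinct xu e)
  square-injective {0F} {2F} e = ⊥-elim (x≢y e)
  square-injective {0F} {3F} e = ⊥-elim (distinct vx (sym e))
  square-injective {1F} {0F} e = ⊥-elim (distinct xu (sym e))
  square-injective {1F} {1F} _ = refl
  square-injective {1F} {2F} e = ⊥-elim (distinct uy e)
  square-injective {1F} {3F} e = ⊥-elim (u≢v e)
  square-injective {2F} {0F} e = ⊥-elim (x≢y (sym e))
  square-injective {2F} {1F} e = ⊥-elim (distinct uy (sym e))
  square-injective {2F} {2F} _ = refl
  square-injective {2F} {3F} e = ⊥-elim (distinct yv e)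
  square-injective {3F} {0F} e = ⊥-elim (distinct vx e)
  square-injective {3F} {1F} e = ⊥-elim (u≢v (sym e))
  square-injective {3F} {2F} e = ⊥-elim (distinct yv (sym e))
  square-injective {3F} {3F} _ = refl

  square-induced : ¬ Edge G x y → ¬ Edge G u v → InducedCycle G 4 f
  square-induced x≁y u≁v = square-injective , adjacency
    where
    adjacent : ∀ {i j} {c : True (CycAdj? 4 i j)} → Edge G (f i) (f j) → Adjacency i j
    adjacent {c = c} e = mk⇔ (λ _ → toWitness c) (λ _ → e)

    non-adjacent : ∀ {i j} {c : False (CycAdj? 4 i j)} → ¬ Edge G (f i) (f j) → Adjacency i j
    non-adjacent {c = c} n = mk⇔ (λ e → ⊥-elim (n e)) (λ a → ⊥-elim (toWitnessFalse c a))

    adjacency : ∀ i j → Adjacency i j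
    adjacency 0F 0F = non-adjacent (Edge-irrefl G)
    adjacency 0F 1F = adjacent xu
    adjacency 0F 2F = non-adjacent x≁y
    adjacency 0F 3F = adjacent (Edge-sym G vx)
    adjacency 1F 0F = adjacent (Edge-sym G xu)
    adjacency 1F 1F = non-adjacent (Edge-irrefl G)
    adjacency 1F 2F = adjacent uy
    adjacency 1F 3F = non-adjacent u≁v
    adjacency 2F 0F = non-adjacent (λ e → x≁y (Edge-sym G e))
    adjacency 2F 1F = adjacent (Edge-sym G uy)
    adjacency 2F 2F = non-adjacent (Edge-irrefl G)
    adjacency 2F 3F = adjacent yv
    adjacency 3F 0F = adjacent vx
    adjacency 3F 1F = non-adjacent (λ e → u≁v (Edge-sym G e))
    adjacency 3F 2F = adjacent (Edge-sym G yv)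
    adjacency 3F 3F = non-adjacent (Edge-irrefl G)

  Chordal⇒square-chord : Chordal G → ¬ Edge G x y → Edge G u v
  Chordal⇒square-chord chordal x≁y with Edge? G u v
  ... | yes uv = uv
  ... | no u≁v = ⊥-elim (chordal 4 ≤-refl f (square-induced x≁y u≁v))

module _ {V : Set} (G : Graph V) {S T : V → Set}
  (non-edge⇒across : ∀ u v → u ≢ v → ¬ Edge G u v → Across S T u v)
  (across⇒non-edge : ∀ u v → S u → T v → ¬ Edge G u v) where

  -- An induced cycle x u y v … has non-adjacent pairs {x, y} and {u, v}, both
  -- across; whichever side u lies on, one of the edges xu, uy is across too.
  chordal-if-non-edges-across : Chordal G
  chordal-if-non-edges-across k (s≤s (s≤s (s≤s (s≤s _)))) f cycle =
    no-path-through-side (f 0F) (f 1F) (f 2F)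
      (InducedCycle-edge G f cycle 0F 1F) (InducedCycle-edge G f cycle 1F 2F)
      (non-adjacent-across 0F 2F (λ ()))
      (Sum.map proj₁ proj₁ (non-adjacent-across 1F 3F (λ ())))
    where
    non-adjacent-across : ∀ i j → i ≢ j → {False (CycAdj? k i j)} → Across S T (f i) (f j)
    non-adjacent-across i j i≢j {c} =
      non-edge⇒across _ _ (λ e → i≢j (proj₁ cycle e)) (InducedCycle-non-edge G f cycle i j {c})

    no-path-through-side : ∀ x u y → Edge G x u → Edge G u y → Across S T x y → S u ⊎ T u → ⊥
    no-path-through-side _ _ _ xu uy (inj₁ (sx , ty)) (inj₁ su) = across⇒non-edge _ _ su ty uy
    no-path-through-side _ _ _ xu uy (inj₁ (sx , ty)) (inj₂ tu) = across⇒non-edge _ _ sx tu xu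
    no-path-through-side _ _ _ xu uy (inj₂ (tx , sy)) (inj₁ su) =
      across⇒non-edge _ _ su tx (Edge-sym G xu)
    no-path-through-side _ _ _ xu uy (inj₂ (tx , sy)) (inj₂ tu) =
      across⇒non-edge _ _ sy tu (Edge-sym G uy)

module Deletion {V : Set} (G : Graph V) {R : V → V → Set} (R? : Decidable R)
  (R-sym : ∀ {u v} → R u v → R v u) where

  deleteEdges : Graph V
  deleteEdges = record
    { adj    = λ u v → not (does (R? u v)) ∧ adj G u v
    ; sym    = λ u v → cong₂ (λ r e → not r ∧ e)
                          (does-⇔ (mk⇔ R-sym R-sym) (R? u v) (R? v u)) (Graph.sym G u v)
    ; irrefl = λ v → trans (cong (not (does (R? v v)) ∧_) (irrefl G v)) (∧-zeroʳ _)
    }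

  deleteEdges-⊆ : deleteEdges ⊆ᴳ G
  deleteEdges-⊆ u v e with does (R? u v)
  ... | false = e

  deleteEdges-keeps : ∀ {u v} → ¬ R u v → Edge G u v → Edge deleteEdges u v
  deleteEdges-keeps {u} {v} ¬r e rewrite dec-false (R? u v) ¬r = e

  deleteEdges-removes : ∀ {u v} → R u v → ¬ Edge deleteEdges u v
  deleteEdges-removes {u} {v} r rewrite dec-true (R? u v) r = λ ()

module _ {V : Set} {E : V → V → Set} {G' : Graph V} (minimal : MinimalChordalSupergraph E G')
  {S T : V → Set} (S? : U.Decidable S) (T? : U.Decidable T) where

  -- G' minus the S–T pairs is chordal and still contains E.
  minimal-omits-across :
    (∀ u v → E u v → ¬ Across S T u v) →
    (∀ u v → u ≢ v → ¬ Across S T u v → Edge G' u v) →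
    ∀ u v → S u → T v → ¬ Edge G' u v
  minimal-omits-across E-avoids G'-elsewhere u v su tv e =
    deleteEdges-removes (inj₁ (su , tv)) (G'⊆H u v e)
    where
    across? : Decidable (Across S T)
    across? = Across? S? T?

    open Deletion G' across? (Across-sym {S = S} {T = T})

    H : Graph V
    H = deleteEdges

    non-edge⇒across : ∀ u v → u ≢ v → ¬ Edge H u v → Across S T u v
    non-edge⇒across u v u≢v u≁v with across? u v
    ... | yes a  = a
    ... | no ¬a = ⊥-elim (u≁v (deleteEdges-keeps ¬a (G'-elsewhere u v u≢v ¬a)))

    G'⊆H : G' ⊆ᴳ H
    G'⊆H = proj₂ (proj₂ minimal) H
      (λ u v e → deleteEdges-keeps (E-avoids u v e) (proj₁ minimal u v e))
      deleteEdges-⊆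
      (chordal-if-non-edges-across H non-edge⇒across
        (λ u v su tv → deleteEdges-removes (inj₁ (su , tv))))

module _ {V : Set} (G : Graph V) {S T : V → Set}
  (S-clique : IsCliqueOn G S) (T-clique : IsCliqueOn G T) where

  clique-on-union : (∀ u v → S u → T v → Edge G u v) → IsCliqueOn G (λ v → S v ⊎ T v)
  clique-on-union S–T u v (inj₁ su) (inj₁ sv) u≢v = S-clique u v su sv u≢v
  clique-on-union S–T u v (inj₁ su) (inj₂ tv) _   = S–T u v su tv
  clique-on-union S–T u v (inj₂ tu) (inj₁ sv) _   = Edge-sym G (S–T v u sv tu)
  clique-on-union S–T u v (inj₂ tu) (inj₂ tv) u≢v = T-clique u v tu tv u≢v

  two-cliques-on-union :
    (S? : U.Decidable S) → (∀ {v} → S v → T v → ⊥) → ∃ S → ∃ T →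
    (∀ u v → S u → T v → ¬ Edge G u v) → IsTwoCliquesOn G (λ v → S v ⊎ T v)
  two-cliques-on-union S? disjoint (s , s∈S) (t , t∈T) S≁T =
    side , (s , inj₁ s∈S , side-S s∈S) , (t , inj₂ t∈T , side-T t∈T) , edge⇔same-side
    where
    side : V → Bool
    side v = does (S? v)

    side-S : ∀ {v} → S v → side v ≡ true
    side-S = dec-true (S? _)

    side-T : ∀ {v} → T v → side v ≡ false
    side-T tv = dec-false (S? _) (λ sv → disjoint sv tv)

    sides-differ : ∀ {u v} → S u → T v → side u ≢ side v
    sides-differ su tv eq = case trans (sym (side-S su)) (trans eq (side-T tv)) of λ ()

    edge⇔same-side : ∀ u v → S u ⊎ T u → S v ⊎ T v → u ≢ v → Edge G u v ⇔ (side u ≡ side v)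
    edge⇔same-side u v (inj₁ su) (inj₁ sv) u≢v =
      mk⇔ (λ _ → trans (side-S su) (sym (side-S sv))) (λ _ → S-clique u v su sv u≢v)
    edge⇔same-side u v (inj₁ su) (inj₂ tv) _ =
      mk⇔ (λ e → ⊥-elim (S≁T u v su tv e)) (λ eq → ⊥-elim (sides-differ su tv eq))
    edge⇔same-side u v (inj₂ tu) (inj₁ sv) _ =
      mk⇔ (λ e → ⊥-elim (S≁T v u sv tu (Edge-sym G e)))
          (λ eq → ⊥-elim (sides-differ sv tu (sym eq)))
    edge⇔same-side u v (inj₂ tu) (inj₂ tv) u≢v =
      mk⇔ (λ _ → trans (side-T tu) (sym (side-T tv))) (λ _ → T-clique u v tu tv u≢v)

all-or-counterexample : ∀ {m n} {P : Fin m → Fin n → Set} → (∀ i j → Dec (P i j)) →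
  (∀ i j → P i j) ⊎ ∃₂ λ i j → ¬ P i j
all-or-counterexample {m} {n} P? with Fin.all? (λ i → Fin.all? (P? i))
... | yes all = inj₁ all
... | no ¬all with Fin.¬∀⟶∃¬ m _ (λ i → Fin.all? (P? i)) ¬all
... | i , ¬all-i with Fin.¬∀⟶∃¬ n _ (P? i) ¬all-i
... | j , ¬Pij = inj₂ (i , j , ¬Pij)

_≟ₚ_ : DecidableEquality Part
p ≟ₚ q = map′ toFin-injective (cong toFin) (toFin p Fin.≟ toFin q)
  where
  toFin : Part → Fin 4
  toFin pA  = 0F
  toFin pB  = 1F
  toFin pB' = 2F
  toFin pC  = 3F

  fromFin : Fin 4 → Part
  fromFin 0F = pA
  fromFin 1F = pB
  fromFin 2F = pB'
  fromFin 3F = pC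

  fromFin-toFin : ∀ p → fromFin (toFin p) ≡ p
  fromFin-toFin pA  = refl
  fromFin-toFin pB  = refl
  fromFin-toFin pB' = refl
  fromFin-toFin pC  = refl

  toFin-injective : ∀ {p q} → toFin p ≡ toFin q → p ≡ q
  toFin-injective {p} {q} e =
    trans (sym (fromFin-toFin p)) (trans (cong fromFin e) (fromFin-toFin q))

SharedBlock : Part → Part → Set
SharedBlock p q = ∃[ β ] (InBlock β p × InBlock β q)

some-block : ∀ p → ∃[ β ] InBlock β p
some-block pA  = AB , inj₁ refl
some-block pB  = AB , inj₂ refl
some-block pB' = AB' , inj₂ refl
some-block pC  = BC , inj₂ refl

-- The parts form the square A – B – C – B'; its diagonals are the pairs of
-- parts not joined by a block.
data Diagonal : Set where
  AC BB' : Diagonal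

end₁ end₂ : Diagonal → Part
end₁ AC  = pA
end₁ BB' = pB
end₂ AC  = pC
end₂ BB' = pB'

other : Diagonal → Diagonal
other AC  = BB'
other BB' = AC

end₁≢end₂ : ∀ d → end₁ d ≢ end₂ d
end₁≢end₂ AC  ()
end₁≢end₂ BB' ()

OnDiagonal : Diagonal → Part → Part → Set
OnDiagonal d = Across (_≡ end₁ d) (_≡ end₂ d)

shared-block-or-diagonal : ∀ p q → SharedBlock p q ⊎ ∃[ d ] OnDiagonal d p q
shared-block-or-diagonal pA  pA  = inj₁ (AB , inj₁ refl , inj₁ refl)
shared-block-or-diagonal pA  pB  = inj₁ (AB , inj₁ refl , inj₂ refl)
shared-block-or-diagonal pA  pB' = inj₁ (AB' , inj₁ refl , inj₂ refl)
shared-block-or-diagonal pA  pC  = inj₂ (AC , inj₁ (refl , refl))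
shared-block-or-diagonal pB  pA  = inj₁ (AB , inj₂ refl , inj₁ refl)
shared-block-or-diagonal pB  pB  = inj₁ (AB , inj₂ refl , inj₂ refl)
shared-block-or-diagonal pB  pB' = inj₂ (BB' , inj₁ (refl , refl))
shared-block-or-diagonal pB  pC  = inj₁ (BC , inj₁ refl , inj₂ refl)
shared-block-or-diagonal pB' pA  = inj₁ (AB' , inj₂ refl , inj₁ refl)
shared-block-or-diagonal pB' pB  = inj₂ (BB' , inj₂ (refl , refl))
shared-block-or-diagonal pB' pB' = inj₁ (AB' , inj₂ refl , inj₂ refl)
shared-block-or-diagonal pB' pC  = inj₁ (B'C , inj₁ refl , inj₂ refl)
shared-block-or-diagonal pC  pA  = inj₂ (AC , inj₂ (refl , refl))
shared-block-or-diagonal pC  pB  = inj₁ (BC , inj₂ refl , inj₁ refl)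
shared-block-or-diagonal pC  pB' = inj₁ (B'C , inj₂ refl , inj₁ refl)
shared-block-or-diagonal pC  pC  = inj₁ (BC , inj₂ refl , inj₂ refl)

no-block-contains-diagonal : ∀ d β → InBlock β (end₁ d) → ¬ InBlock β (end₂ d)
no-block-contains-diagonal AC  AB  _ (inj₁ ())
no-block-contains-diagonal AC  AB  _ (inj₂ ())
no-block-contains-diagonal AC  AB' _ (inj₁ ())
no-block-contains-diagonal AC  AB' _ (inj₂ ())
no-block-contains-diagonal AC  BC  (inj₁ ()) _
no-block-contains-diagonal AC  BC  (inj₂ ()) _
no-block-contains-diagonal AC  B'C (inj₁ ()) _
no-block-contains-diagonal AC  B'C (inj₂ ()) _
no-block-contains-diagonal BB' AB  _ (inj₁ ())
no-block-contains-diagonal BB' AB  _ (inj₂ ())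
no-block-contains-diagonal BB' AB' (inj₁ ()) _
no-block-contains-diagonal BB' AB' (inj₂ ()) _
no-block-contains-diagonal BB' BC  _ (inj₁ ())
no-block-contains-diagonal BB' BC  _ (inj₂ ())
no-block-contains-diagonal BB' B'C (inj₁ ()) _
no-block-contains-diagonal BB' B'C (inj₂ ()) _

shared-block-not-diagonal : ∀ d {p q} → SharedBlock p q → ¬ OnDiagonal d p q
shared-block-not-diagonal d (β , bp , bq) (inj₁ (refl , refl)) = no-block-contains-diagonal d β bp bq
shared-block-not-diagonal d (β , bp , bq) (inj₂ (refl , refl)) = no-block-contains-diagonal d β bq bp

module _ {a b c : ℕ} where

  InPart : Part → Vtx a b c → Set
  InPart p v = part v ≡ p

  InDiagonal : Diagonal → Vtx a b c → Set
  InDiagonal d v = InPart (end₁ d) v ⊎ InPart (end₂ d) v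

  size : Part → ℕ
  size pA  = a
  size pB  = b
  size pB' = b
  size pC  = c

  vertex : ∀ p → Fin (size p) → Vtx a b c
  vertex pA  i = inj₁ i
  vertex pB  i = inj₂ (inj₁ i)
  vertex pB' i = inj₂ (inj₂ (inj₁ i))
  vertex pC  i = inj₂ (inj₂ (inj₂ i))

  InPart⇒vertex : ∀ {p} v → InPart p v → ∃[ i ] vertex p i ≡ v
  InPart⇒vertex (inj₁ i)                   refl = i , refl
  InPart⇒vertex (inj₂ (inj₁ i))            refl = i , refl
  InPart⇒vertex (inj₂ (inj₂ (inj₁ i)))     refl = i , refl
  InPart⇒vertex (inj₂ (inj₂ (inj₂ i)))     refl = i , refl

  between-parts : ∀ {p q} {P : Vtx a b c → Vtx a b c → Set} →
    (∀ i j → P (vertex p i) (vertex q j)) → ∀ u v → InPart p u → InPart q v → P u v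
  between-parts P-vertices u v pu qv with InPart⇒vertex u pu | InPart⇒vertex v qv
  ... | i , refl | j , refl = P-vertices i j

  EdgeG-within-part : ∀ {p} u v → InPart p u → InPart p v → u ≢ v → EdgeG u v
  EdgeG-within-part u v refl pv u≢v =
    let (β , m) = some-block (part u) in u≢v , β , m , subst (InBlock β) (sym pv) m

  EdgeG-not-diagonal : ∀ d {u v : Vtx a b c} → EdgeG u v → ¬ OnDiagonal d (part u) (part v)
  EdgeG-not-diagonal d (_ , shared) = shared-block-not-diagonal d shared

  EdgeG-off-diagonals : ∀ d {u v : Vtx a b c} → u ≢ v →
    ¬ OnDiagonal d (part u) (part v) → ¬ OnDiagonal (other d) (part u) (part v) → EdgeG u v
  EdgeG-off-diagonals d {u} {v} u≢v ¬on ¬on-other with shared-block-or-diagonal (part u) (part v)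
  ... | inj₁ shared = u≢v , shared
  ... | inj₂ (d' , on) with d | d'
  ...   | AC  | AC  = ⊥-elim (¬on on)
  ...   | AC  | BB' = ⊥-elim (¬on-other on)
  ...   | BB' | AC  = ⊥-elim (¬on-other on)
  ...   | BB' | BB' = ⊥-elim (¬on on)

module _ {a b c : ℕ} (G' : Graph (Vtx a b c)) (minimal : MinimalChordalSupergraph EdgeG G') where

  private
    EdgeG⊆G' : ∀ u v → EdgeG u v → Edge G' u v
    EdgeG⊆G' = proj₁ minimal

    InPart? : ∀ p → U.Decidable (InPart {a} {b} {c} p)
    InPart? p v = part v ≟ₚ p

  part-clique : ∀ p → IsCliqueOn G' (InPart p)
  part-clique p u v pu pv u≢v = EdgeG⊆G' u v (EdgeG-within-part u v pu pv u≢v)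

  Complete : Diagonal → Set
  Complete d = ∀ u v → InPart (end₁ d) u → InPart (end₂ d) v → Edge G' u v

  Empty : Diagonal → Set
  Empty d = ∀ u v → InPart (end₁ d) u → InPart (end₂ d) v → ¬ Edge G' u v

  complete-diagonal⇒empty-other : ∀ d → Complete (other d) → Empty d
  complete-diagonal⇒empty-other d complete =
    minimal-omits-across {E = EdgeG} {G' = G'} minimal (InPart? (end₁ d)) (InPart? (end₂ d))
      (λ u v → EdgeG-not-diagonal d) G'-off-d
    where
    G'-off-d : ∀ u v → u ≢ v → ¬ OnDiagonal d (part u) (part v) → Edge G' u v
    G'-off-d u v u≢v ¬on with Across? (InPart? (end₁ (other d))) (InPart? (end₂ (other d))) u v
    ... | yes (inj₁ (e₁u , e₂v)) = complete u v e₁u e₂v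
    ... | yes (inj₂ (e₂u , e₁v)) = Edge-sym G' (complete v u e₁v e₂u)
    ... | no ¬on-other = EdgeG⊆G' u v (EdgeG-off-diagonals d u≢v ¬on ¬on-other)

  complete-diagonal⇒split-other : ∀ d → Complete (other d) →
    ∃ (InPart (end₁ d)) → ∃ (InPart (end₂ d)) →
    IsCliqueOn G' (InDiagonal (other d)) × IsTwoCliquesOn G' (InDiagonal d)
  complete-diagonal⇒split-other d complete nonempty₁ nonempty₂ =
    clique-on-union G' (part-clique _) (part-clique _) complete ,
    two-cliques-on-union G' (part-clique _) (part-clique _) (InPart? (end₁ d))
      (λ e₁v e₂v → end₁≢end₂ d (trans (sym e₁v) e₂v)) nonempty₁ nonempty₂
      (complete-diagonal⇒empty-other d complete)

  missing-AC⇒complete-BB' : ∀ {i j} → ¬ Edge G' (vertex pA i) (vertex pC j) →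
    ∀ x y → Edge G' (vertex pB x) (vertex pB' y)
  missing-AC⇒complete-BB' a≁c x y =
    Chordal⇒square-chord G' (λ ()) (λ ())
      (EdgeG⊆G' _ _ ((λ ()) , AB , inj₁ refl , inj₂ refl))
      (EdgeG⊆G' _ _ ((λ ()) , BC , inj₁ refl , inj₂ refl))
      (EdgeG⊆G' _ _ ((λ ()) , B'C , inj₂ refl , inj₁ refl))
      (EdgeG⊆G' _ _ ((λ ()) , AB' , inj₂ refl , inj₁ refl))
      (proj₁ (proj₂ minimal)) a≁c

  AC-complete-or-missing : (∀ i j → Edge G' (vertex pA i) (vertex pC j)) ⊎
                           ∃₂ λ i j → ¬ Edge G' (vertex pA i) (vertex pC j)
  AC-complete-or-missing = all-or-counterexample (λ i j → Edge? G' _ _)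

lemma5 : (a b c : ℕ) → 1 ≤ a → a < b → b < c → b * b < a * c →
    (G' : Graph (Vtx a b c)) → MinimalChordalSupergraph EdgeG G' →
    (IsCliqueOn G' InAC ⊎ IsTwoCliquesOn G' InAC) ×
    (IsCliqueOn G' InBB' ⊎ IsTwoCliquesOn G' InBB')
lemma5 a b c _ a<b _ _ G' minimal with AC-complete-or-missing G' minimal
... | inj₁ AC-complete =
  Product.map inj₁ inj₂
    (complete-diagonal⇒split-other G' minimal BB' (between-parts AC-complete)
      (vertex pB b₀ , refl) (vertex pB' b₀ , refl))
  where
  b₀ : Fin b
  b₀ = fromℕ< a<b
... | inj₂ (i , j , a≁c) =
  Product.swap (Product.map inj₁ inj₂
    (complete-diagonal⇒split-other G' minimal AC
      (between-parts (missing-AC⇒complete-BB' G' minimal a≁c))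
      (vertex pA i , refl) (vertex pC j , refl)))
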